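{- For every integer $n\ge 2$, the fan graph $F_n$ does not have a canonical ESD labeling if and only if $n\ge 8$.
   Context: The fan graph $F_n$ consists of a path $P_{n-1}$ on $n-1$ vertices together with one additional vertex (the central vertex) joined by an edge to every vertex of the path; it has $n$ vertices. For a graph $G=(V,E)$ and $l\in\mathbb N$, a vertex labeling $\phi:V\to\{1,\dots,l\}$ is an edge-sum distinguishing (ESD) labeling if $\phi$ is injective and the edge-weights $w_\phi(uv)=\phi(u)+\phi(v)$ are pairwise distinct over all edges $uv\in E$. It is a canonical ESD labeling if $l=|V|$. -}

module Defs where

open import Data.Nat using (ℕ; zero; suc; _+_; _≤_; _<_; s≤s)
open import Data.Nat.Properties using (≤-refl)
open import Data.Fin using (Fin; toℕ)
open import Data.Product using (_×_; Σ)
open import Relation.Binary.PropositionalEquality using (_≡_)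
open import Function.Definitions using (Injective)

-- A (simple, undirected) graph on vertex set Fin n, given by its edge
-- relation on ordered pairs (u , v) with toℕ u < toℕ v (each edge listed once).
record Graph (n : ℕ) : Set₁ where
  field
    Edge : Fin n → Fin n → Set
    edge-ordered : ∀ {u v} → Edge u v → toℕ u < toℕ v

-- Fan graph F_n: vertex 0 is the central vertex; vertices 1,…,n-1 form the
-- path P_{n-1} (edges {i, i+1}); the centre is joined to every path vertex.
data FanEdge (n : ℕ) : Fin n → Fin n → Set where
  spoke : ∀ {u v : Fin n} → toℕ u ≡ 0 → 1 ≤ toℕ v → FanEdge n u v
  path  : ∀ {u v : Fin n} → 1 ≤ toℕ u → toℕ v ≡ suc (toℕ u) → FanEdge n u v

fan-ordered : ∀ {n} {u v : Fin n} → FanEdge n u v → toℕ u < toℕ v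
fan-ordered (spoke {u} {v} u0 v1) rewrite u0 = v1
fan-ordered (path {u} {v} u1 vs) rewrite vs = s≤s ≤-refl

Fan : (n : ℕ) → Graph n
Fan n = record { Edge = FanEdge n ; edge-ordered = fan-ordered }

record IsESDLabeling {n : ℕ} (G : Graph n) (l : ℕ) (φ : Fin n → ℕ) : Set where
  open Graph G
  field
    range     : ∀ v → 1 ≤ φ v × φ v ≤ l
    injective : Injective _≡_ _≡_ φ
    distinct-weights : ∀ {u v u′ v′} → Edge u v → Edge u′ v′ →
                       φ u + φ v ≡ φ u′ + φ v′ → (u ≡ u′ × v ≡ v′)

HasESDLabeling : {n : ℕ} → Graph n → ℕ → Set
HasESDLabeling G l = Σ (Fin _ → ℕ) (IsESDLabeling G l)

HasCanonicalESDLabeling : {n : ℕ} → Graph n → Set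
HasCanonicalESDLabeling {n} G = HasESDLabeling G n

module Submission where

-- Existence for 2 ≤ n ≤ 7.  Being an ESD labeling is decidable on any graph
-- with decidable edges, so an explicit labeling of each small fan is
-- certified by evaluating the decision procedure.
--
-- Non-existence for n ≥ 8.  F_n has (n - 1) + (n - 2) = 2n - 3 edges, and two
-- distinct labels from {1,…,n} sum to a value in [3, 2n - 1], an interval of
-- 2n - 3 values; by pigeonhole every value is an edge weight.  If the centre
-- label is ≥ 5, every spoke weighs ≥ 6, so weights 3, 4, 5 sit on path edges
-- labelled {1,2}, {1,3} and {1,4} or {2,3}: the vertex labelled 1 gets three
-- path neighbours, or the path gets a triangle.  So the centre label is ≤ 4.
-- The complement v ↦ n + 1 - φ v is again ESD, with centre label ≥ n - 3 ≥ 5.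

open import Defs
open import Data.Nat.Properties
open import Algebra.Properties.CommutativeSemigroup +-commutativeSemigroup
  using (interchange)
open import Data.Empty using (⊥; ⊥-elim)
open import Data.Fin as Fin using (Fin; zero; suc; toℕ; fromℕ<; inject₁; splitAt; join; punchOut)
open import Data.Fin.Properties
  using (all?; any?; injective⇒≤; punchOut-injective; toℕ-fromℕ<; toℕ-injective;
         toℕ-inject₁; inject₁-injective; join-splitAt)
  renaming (suc-injective to fsuc-injective)
open import Data.Nat using (ℕ; zero; suc; _+_; _∸_; _≤_; _<_; z≤n; s≤s; _≤?_; _≟_)
open import Data.Product using (_×_; _,_; proj₁; proj₂; ∃)
open import Data.Sum using (_⊎_; inj₁; inj₂)
open import Data.Vec using (Vec; []; _∷_; lookup)
open import Function.Base using (_∘_)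
open import Function.Bundles using (_⇔_; mk⇔)
open import Function.Definitions using (Injective)
open import Relation.Nullary using (¬_; Dec; yes; no)
open import Relation.Nullary.Decidable
  using (True; toWitness; map′; _×-dec_; _⊎-dec_; _→-dec_)
open import Relation.Binary.PropositionalEquality
  using (_≡_; _≢_; refl; sym; trans; cong; cong₂; subst)

fanEdge? : ∀ {n} (u v : Fin n) → Dec (FanEdge n u v)
fanEdge? {n} u v = map′ fromCases toCases
  ((toℕ u ≟ 0 ×-dec 1 ≤? toℕ v) ⊎-dec (1 ≤? toℕ u ×-dec toℕ v ≟ suc (toℕ u)))
  where
  Cases : Set
  Cases = (toℕ u ≡ 0 × 1 ≤ toℕ v) ⊎ (1 ≤ toℕ u × toℕ v ≡ suc (toℕ u))
  fromCases : Cases → FanEdge n u v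
  fromCases (inj₁ (u≡0 , 1≤v))   = spoke u≡0 1≤v
  fromCases (inj₂ (1≤u , v≡1+u)) = path 1≤u v≡1+u
  toCases : FanEdge n u v → Cases
  toCases (spoke u≡0 1≤v)   = inj₁ (u≡0 , 1≤v)
  toCases (path 1≤u v≡1+u) = inj₂ (1≤u , v≡1+u)

isESDLabeling? : ∀ {n} (G : Graph n) → (∀ u v → Dec (Graph.Edge G u v)) →
                 ∀ l (φ : Fin n → ℕ) → Dec (IsESDLabeling G l φ)
isESDLabeling? G edge? l φ =
  map′ assemble split (inRange? ×-dec (injective? ×-dec distinctWeights?))
  where
  open Graph G
  InRange DistinctLabels DistinctWeights : Set
  InRange         = ∀ v → 1 ≤ φ v × φ v ≤ l
  DistinctLabels  = ∀ x y → φ x ≡ φ y → x ≡ y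
  DistinctWeights = ∀ u v u′ v′ → Edge u v → Edge u′ v′ →
                    φ u + φ v ≡ φ u′ + φ v′ → u ≡ u′ × v ≡ v′
  inRange? : Dec InRange
  inRange? = all? λ v → 1 ≤? φ v ×-dec φ v ≤? l
  injective? : Dec DistinctLabels
  injective? = all? λ x → all? λ y → φ x ≟ φ y →-dec x Fin.≟ y
  distinctWeights? : Dec DistinctWeights
  distinctWeights? = all? λ u → all? λ v → all? λ u′ → all? λ v′ →
    edge? u v →-dec (edge? u′ v′ →-dec
      (φ u + φ v ≟ φ u′ + φ v′ →-dec (u Fin.≟ u′ ×-dec v Fin.≟ v′)))
  assemble : InRange × DistinctLabels × DistinctWeights → IsESDLabeling G l φ
  assemble (r , i , w) = record
    { range = r
    ; injective = λ {x} {y} → i x y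
    ; distinct-weights = λ {u} {v} {u′} {v′} → w u v u′ v′
    }
  split : IsESDLabeling G l φ → InRange × DistinctLabels × DistinctWeights
  split E = range , (λ _ _ → injective) , (λ _ _ _ _ → distinct-weights)
    where open IsESDLabeling E

-- A list of labels (centre first, then the path in order) whose ESD-ness is
-- confirmed by evaluating the decision procedure.
certified : ∀ {n} (labels : Vec ℕ n) →
            True (isESDLabeling? (Fan n) fanEdge? n (lookup labels)) →
            HasCanonicalESDLabeling (Fan n)
certified labels ok = lookup labels , toWitness ok

small-fan-labeling : ∀ n → 2 ≤ n → n < 8 → HasCanonicalESDLabeling (Fan n)
small-fan-labeling 0 () _
small-fan-labeling 1 (s≤s ()) _
small-fan-labeling 2 _ _ = certified (1 ∷ 2 ∷ []) _
small-fan-labeling 3 _ _ = certified (1 ∷ 2 ∷ 3 ∷ []) _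
small-fan-labeling 4 _ _ = certified (1 ∷ 2 ∷ 4 ∷ 3 ∷ []) _
small-fan-labeling 5 _ _ = certified (2 ∷ 1 ∷ 3 ∷ 5 ∷ 4 ∷ []) _
small-fan-labeling 6 _ _ = certified (3 ∷ 1 ∷ 2 ∷ 4 ∷ 6 ∷ 5 ∷ []) _
small-fan-labeling 7 _ _ = certified (4 ∷ 2 ∷ 1 ∷ 3 ∷ 5 ∷ 7 ∷ 6 ∷ []) _
small-fan-labeling (suc (suc (suc (suc (suc (suc (suc (suc _)))))))) _
  (s≤s (s≤s (s≤s (s≤s (s≤s (s≤s (s≤s (s≤s ()))))))))

distinct-sum-bounds : ∀ {a b l} → a ≢ b → 1 ≤ a → 1 ≤ b → a ≤ l → b ≤ l →
                      3 ≤ a + b × a + b < l + l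
distinct-sum-bounds {a} {b} {l} a≢b 1≤a 1≤b a≤l b≤l = lower a≢b 1≤a 1≤b , upper
  where
  lower : ∀ {a b} → a ≢ b → 1 ≤ a → 1 ≤ b → 3 ≤ a + b
  lower {1} {1} 1≢1 _ _ = ⊥-elim (1≢1 refl)
  lower {1} {suc (suc b)} _ _ _ = s≤s (s≤s (s≤s z≤n))
  lower {suc (suc a)} {suc b} _ _ _ rewrite +-suc a b = s≤s (s≤s (s≤s z≤n))
  upper : a + b < l + l
  upper with m≤n⇒m<n∨m≡n a≤l | m≤n⇒m<n∨m≡n b≤l
  ... | inj₁ a<l | _        = +-mono-<-≤ a<l b≤l
  ... | inj₂ _   | inj₁ b<l = +-mono-≤-< a≤l b<l
  ... | inj₂ a≡l | inj₂ b≡l = ⊥-elim (a≢b (trans a≡l (sym b≡l)))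

-- Pigeonhole: an injective map from Fin N into the N-element interval
-- [lo, lo + N) attains every value of that interval.  A missed value would
-- let us squeeze the N points into the N - 1 remaining positions.
interval-surjective : ∀ {N lo} (g : Fin N → ℕ) → Injective _≡_ _≡_ g →
                      (∀ k → lo ≤ g k × g k < lo + N) →
                      ∀ {w} → lo ≤ w → w < lo + N → ∃ λ k → g k ≡ w
interval-surjective {zero} {lo} _ _ _ lo≤w w<lo+0 =
  ⊥-elim (<⇒≱ w<lo+0 (subst (_≤ _) (sym (+-identityʳ lo)) lo≤w))
interval-surjective {suc M} {lo} g g-injective g-range {w} lo≤w w<lo+N
  with any? (λ k → g k ≟ w)
... | yes hit = hit
... | no miss = ⊥-elim (1+n≰n (injective⇒≤ squeeze-injective))
  where
  offset : ∀ {x} → x < lo + suc M → Fin (suc M)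
  offset {x} x<lo+N = fromℕ< (m<n+o⇒m∸n<o x lo x<lo+N)
  offset-injective : ∀ {x y} (x< : x < lo + suc M) (y< : y < lo + suc M) →
                     lo ≤ x → lo ≤ y → offset x< ≡ offset y< → x ≡ y
  offset-injective x< y< lo≤x lo≤y eq = ∸-cancelʳ-≡ lo≤x lo≤y
    (trans (sym (toℕ-fromℕ< _)) (trans (cong toℕ eq) (toℕ-fromℕ< _)))
  gap≢offset : ∀ k → offset w<lo+N ≢ offset (proj₂ (g-range k))
  gap≢offset k eq =
    miss (k , sym (offset-injective w<lo+N (proj₂ (g-range k)) lo≤w (proj₁ (g-range k)) eq))
  squeeze : Fin (suc M) → Fin M
  squeeze k = punchOut (gap≢offset k)
  squeeze-injective : Injective _≡_ _≡_ squeeze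
  squeeze-injective {k} {k′} eq = g-injective
    (offset-injective (proj₂ (g-range k)) (proj₂ (g-range k′)) (proj₁ (g-range k)) (proj₁ (g-range k′))
      (punchOut-injective (gap≢offset k) (gap≢offset k′) eq))

_~_ : ℕ → ℕ → Set
x ~ y = suc x ≡ y ⊎ suc y ≡ x

~-sym : ∀ {x y} → x ~ y → y ~ x
~-sym (inj₁ eq) = inj₂ eq
~-sym (inj₂ eq) = inj₁ eq

at-most-two-neighbours : ∀ {x a b c} → x ~ a → x ~ b → x ~ c →
                         a ≢ b → a ≢ c → b ≢ c → ⊥
at-most-two-neighbours (inj₁ refl) (inj₁ refl) _ a≢b _ _ = a≢b refl
at-most-two-neighbours (inj₂ a+1≡x) (inj₂ b+1≡x) _ a≢b _ _ =
  a≢b (suc-injective (trans a+1≡x (sym b+1≡x)))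
at-most-two-neighbours (inj₁ refl) (inj₂ refl) (inj₁ refl) _ a≢c _ = a≢c refl
at-most-two-neighbours (inj₁ refl) (inj₂ refl) (inj₂ c+1≡x) _ _ b≢c =
  b≢c (sym (suc-injective c+1≡x))
at-most-two-neighbours (inj₂ refl) (inj₁ refl) (inj₁ refl) _ _ b≢c = b≢c refl
at-most-two-neighbours (inj₂ refl) (inj₁ refl) (inj₂ c+1≡x) _ a≢c _ =
  a≢c (sym (suc-injective c+1≡x))

no-triangle : ∀ {x a b} → x ~ a → x ~ b → a ~ b → ⊥
no-triangle (inj₁ refl) (inj₁ refl) (inj₁ ())
no-triangle (inj₁ refl) (inj₁ refl) (inj₂ ())
no-triangle (inj₁ refl) (inj₂ refl) (inj₁ ())
no-triangle (inj₁ refl) (inj₂ refl) (inj₂ ())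
no-triangle (inj₂ refl) (inj₁ refl) (inj₁ ())
no-triangle (inj₂ refl) (inj₁ refl) (inj₂ ())
no-triangle (inj₂ refl) (inj₂ refl) (inj₁ ())
no-triangle (inj₂ refl) (inj₂ refl) (inj₂ ())

_≐_ : ℕ × ℕ → ℕ × ℕ → Set
(a , b) ≐ (x , y) = (a ≡ x × b ≡ y) ⊎ (a ≡ y × b ≡ x)

sum≡3 : ∀ a b → 1 ≤ a → 1 ≤ b → a + b ≡ 3 → (a , b) ≐ (1 , 2)
sum≡3 1 _ _ _ refl = inj₁ (refl , refl)
sum≡3 2 _ _ _ refl = inj₂ (refl , refl)
sum≡3 3 _ _ () refl
sum≡3 (suc (suc (suc (suc _)))) _ _ _ ()

sum≡4 : ∀ a b → 1 ≤ a → 1 ≤ b → a ≢ b → a + b ≡ 4 → (a , b) ≐ (1 , 3)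
sum≡4 1 _ _ _ _ refl = inj₁ (refl , refl)
sum≡4 2 _ _ _ 2≢2 refl = ⊥-elim (2≢2 refl)
sum≡4 3 _ _ _ _ refl = inj₂ (refl , refl)
sum≡4 4 _ _ () _ refl
sum≡4 (suc (suc (suc (suc (suc _))))) _ _ _ _ ()

sum≡5 : ∀ a b → 1 ≤ a → 1 ≤ b → a + b ≡ 5 → (a , b) ≐ (1 , 4) ⊎ (a , b) ≐ (2 , 3)
sum≡5 1 _ _ _ refl = inj₁ (inj₁ (refl , refl))
sum≡5 2 _ _ _ refl = inj₂ (inj₁ (refl , refl))
sum≡5 3 _ _ _ refl = inj₂ (inj₂ (refl , refl))
sum≡5 4 _ _ _ refl = inj₁ (inj₂ (refl , refl))
sum≡5 5 _ _ () refl
sum≡5 (suc (suc (suc (suc (suc (suc _)))))) _ _ _ ()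

-- Reflecting the labels, v ↦ l + 1 - φ v, preserves ESD-ness on any graph:
-- each new weight is 2(l + 1) minus the old one, so distinct weights stay
-- distinct.
complement : ∀ {n} {G : Graph n} {l} {φ : Fin n → ℕ} →
             IsESDLabeling G l φ → IsESDLabeling G l (λ v → suc l ∸ φ v)
complement {G = G} {l} {φ} E = record
  { range = λ v → m<n⇒0<n∸m (s≤s (proj₂ (range v))) , ∸-monoʳ-≤ (suc l) (proj₁ (range v))
  ; injective = λ {x} {y} eq → injective (∸-cancelˡ-≡ (φ≤1+l x) (φ≤1+l y) eq)
  ; distinct-weights = λ {u} {v} {u′} {v′} e e′ eq →
      distinct-weights e e′ (+-cancelˡ-≡ (ψ u + ψ v) _ _
        (trans (weights-add-up u v) (sym (trans (cong (_+ (φ u′ + φ v′)) eq) (weights-add-up u′ v′)))))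
  }
  where
  open IsESDLabeling E
  ψ : Fin _ → ℕ
  ψ v = suc l ∸ φ v
  φ≤1+l : ∀ v → φ v ≤ suc l
  φ≤1+l v = m≤n⇒m≤1+n (proj₂ (range v))
  weights-add-up : ∀ u v → (ψ u + ψ v) + (φ u + φ v) ≡ suc l + suc l
  weights-add-up u v = trans (interchange (ψ u) (ψ v) (φ u) (φ v))
    (cong₂ _+_ (m∸n+n≡m (φ≤1+l u)) (m∸n+n≡m (φ≤1+l v)))

module CanonicalFanLabeling {p : ℕ} {φ : Fin (suc (suc p)) → ℕ}
                            (E : IsESDLabeling (Fan (suc (suc p))) (suc (suc p)) φ) where
  open IsESDLabeling E

  left right : Fin p → Fin (suc (suc p))
  left j = suc (inject₁ j)
  right j = suc (suc j)

  spoke-edge : ∀ i → FanEdge (suc (suc p)) zero (suc i)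
  spoke-edge i = spoke refl (s≤s z≤n)

  path-edge : ∀ j → FanEdge (suc (suc p)) (left j) (right j)
  path-edge j = path (s≤s z≤n) (cong (λ x → suc (suc x)) (sym (toℕ-inject₁ j)))

  left~right : ∀ j → toℕ (left j) ~ toℕ (right j)
  left~right j = inj₁ (cong (λ x → suc (suc x)) (toℕ-inject₁ j))

  left≢right : ∀ j → left j ≢ right j
  left≢right j eq =
    <⇒≢ (n<1+n (toℕ j)) (trans (sym (toℕ-inject₁ j)) (cong toℕ (fsuc-injective eq)))

  label≥1 : ∀ v → 1 ≤ φ v
  label≥1 v = proj₁ (range v)

  labels-differ : ∀ {x y} → x ≢ y → φ x ≢ φ y
  labels-differ x≢y eq = x≢y (injective eq)

  Edge : Set
  Edge = Fin (suc p) ⊎ Fin p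

  tail head : Edge → Fin (suc (suc p))
  tail (inj₁ _) = zero
  tail (inj₂ j) = left j
  head (inj₁ i) = suc i
  head (inj₂ j) = right j

  ends-differ : ∀ e → tail e ≢ head e
  ends-differ (inj₁ _) ()
  ends-differ (inj₂ j) = left≢right j

  weight : Edge → ℕ
  weight e = φ (tail e) + φ (head e)

  weight-injective : Injective _≡_ _≡_ weight
  weight-injective {inj₁ i} {inj₁ i′} eq =
    cong inj₁ (fsuc-injective (proj₂ (distinct-weights (spoke-edge i) (spoke-edge i′) eq)))
  weight-injective {inj₁ i} {inj₂ j} eq
    with () ← proj₁ (distinct-weights (spoke-edge i) (path-edge j) eq)
  weight-injective {inj₂ j} {inj₁ i} eq
    with () ← proj₁ (distinct-weights (path-edge j) (spoke-edge i) eq)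
  weight-injective {inj₂ j} {inj₂ j′} eq = cong inj₂ (inject₁-injective (fsuc-injective
    (proj₁ (distinct-weights (path-edge j) (path-edge j′) eq))))

  -- All weights lie in [3, 2n - 1], an interval with as many values as edges.
  weight-range : ∀ e → 3 ≤ weight e × weight e < 3 + (suc p + p)
  weight-range e with distinct-sum-bounds (labels-differ (ends-differ e))
                        (label≥1 _) (label≥1 _) (proj₂ (range _)) (proj₂ (range _))
  ... | 3≤w , w<2n = 3≤w , subst (weight e <_) 2n≡3+edges w<2n
    where
    2n≡3+edges : suc (suc p) + suc (suc p) ≡ 3 + (suc p + p)
    2n≡3+edges = cong (λ x → suc (suc x)) (trans (+-suc p (suc p)) (cong suc (+-suc p p)))

  numbered : Fin (suc p + p) → Edge
  numbered = splitAt (suc p)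

  numbered-injective : Injective _≡_ _≡_ numbered
  numbered-injective {k} {k′} eq = trans (sym (join-splitAt (suc p) p k))
    (trans (cong (join (suc p) p) eq) (join-splitAt (suc p) p k′))

  weight-onto : ∀ {w} → 3 ≤ w → w < 3 + (suc p + p) → ∃ λ e → weight e ≡ w
  weight-onto 3≤w w<2n
    with k , eq ← interval-surjective (weight ∘ numbered)
                    (λ eq → numbered-injective (weight-injective eq))
                    (weight-range ∘ numbered) 3≤w w<2n
    = numbered k , eq

  record LabelledPathEdge (a b : ℕ) : Set where
    constructor labelled
    field
      {x y}    : Fin (suc (suc p))
      x-label  : φ x ≡ a
      y-label  : φ y ≡ b
      adjacent : toℕ x ~ toℕ y

  path-edge-labelled : ∀ j {a b} → (φ (left j) , φ (right j)) ≐ (a , b) → LabelledPathEdge a b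
  path-edge-labelled j (inj₁ (l≡a , r≡b)) = labelled l≡a r≡b (left~right j)
  path-edge-labelled j (inj₂ (l≡b , r≡a)) = labelled r≡a l≡b (~-sym (left~right j))

  -- With centre label ≥ 5 every spoke weighs ≥ 6, so each weight w ≤ 5 is
  -- carried by a path edge.
  light-path-edge : 5 ≤ φ zero → ∀ {w} → 3 ≤ w → w ≤ 5 →
                    ∃ λ j → φ (left j) + φ (right j) ≡ w
  light-path-edge 5≤c {w} 3≤w w≤5 with weight-onto 3≤w w<2n
    where
    w<2n : w < 3 + (suc p + p)
    w<2n = ≤-<-trans (≤-trans w≤5 (≤-trans 5≤c (proj₂ (range zero))))
                     (s≤s (s≤s (s≤s (m≤n⇒m≤1+n (m≤m+n p p)))))
  ... | inj₂ j , eq = j , eq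
  ... | inj₁ i , eq =
    ⊥-elim (1+n≰n (≤-trans (subst (6 ≤_) eq (+-mono-≤ 5≤c (label≥1 (suc i)))) w≤5))

  edge-1-2 : 5 ≤ φ zero → LabelledPathEdge 1 2
  edge-1-2 5≤c =
    let j , eq = light-path-edge 5≤c {3} (s≤s (s≤s (s≤s z≤n))) (s≤s (s≤s (s≤s z≤n)))
    in path-edge-labelled j (sum≡3 _ _ (label≥1 _) (label≥1 _) eq)

  edge-1-3 : 5 ≤ φ zero → LabelledPathEdge 1 3
  edge-1-3 5≤c =
    let j , eq = light-path-edge 5≤c {4} (s≤s (s≤s (s≤s z≤n))) (s≤s (s≤s (s≤s (s≤s z≤n))))
    in path-edge-labelled j
         (sum≡4 _ _ (label≥1 _) (label≥1 _) (labels-differ (left≢right j)) eq)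

  edge-weight-5 : 5 ≤ φ zero → LabelledPathEdge 1 4 ⊎ LabelledPathEdge 2 3
  edge-weight-5 5≤c
    with j , eq ← light-path-edge 5≤c {5} (s≤s (s≤s (s≤s z≤n))) ≤-refl
    with sum≡5 _ _ (label≥1 (left j)) (label≥1 (right j)) eq
  ... | inj₁ lbl14 = inj₁ (path-edge-labelled j lbl14)
  ... | inj₂ lbl23 = inj₂ (path-edge-labelled j lbl23)

  positions-differ : ∀ {x y a b} → φ x ≡ a → φ y ≡ b → a ≢ b → toℕ x ≢ toℕ y
  positions-differ φx≡a φy≡b a≢b eq =
    a≢b (trans (sym φx≡a) (trans (cong φ (toℕ-injective eq)) φy≡b))

  no-labelled-star : LabelledPathEdge 1 2 → LabelledPathEdge 1 3 → LabelledPathEdge 1 4 → ⊥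
  no-labelled-star (labelled x≡1 y≡2 x~y) (labelled x′≡1 y′≡3 x′~y′) (labelled x″≡1 y″≡4 x″~y″)
    with refl ← injective (trans x≡1 (sym x′≡1))
    with refl ← injective (trans x≡1 (sym x″≡1))
    = at-most-two-neighbours x~y x′~y′ x″~y″
        (positions-differ y≡2 y′≡3 λ ())
        (positions-differ y≡2 y″≡4 λ ())
        (positions-differ y′≡3 y″≡4 λ ())

  no-labelled-triangle : LabelledPathEdge 1 2 → LabelledPathEdge 1 3 → LabelledPathEdge 2 3 → ⊥
  no-labelled-triangle (labelled x≡1 y≡2 x~y) (labelled x′≡1 y′≡3 x′~y′) (labelled z≡2 z′≡3 z~z′)
    with refl ← injective (trans x≡1 (sym x′≡1))
    with refl ← injective (trans y≡2 (sym z≡2))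
    with refl ← injective (trans y′≡3 (sym z′≡3))
    = no-triangle x~y x′~y′ z~z′

  centre-label≤4 : φ zero ≤ 4
  centre-label≤4 = ≮⇒≥ large-centre-impossible
    where
    large-centre-impossible : ¬ (5 ≤ φ zero)
    large-centre-impossible 5≤c with edge-weight-5 5≤c
    ... | inj₁ e14 = no-labelled-star (edge-1-2 5≤c) (edge-1-3 5≤c) e14
    ... | inj₂ e23 = no-labelled-triangle (edge-1-2 5≤c) (edge-1-3 5≤c) e23

-- For n ≥ 8 the fan F_n has no canonical ESD labeling: both φ and its
-- complement would need centre label ≤ 4, yet the two centre labels sum
-- to n + 1 ≥ 9.
large-fan-no-labeling : ∀ n → 8 ≤ n → ¬ HasCanonicalESDLabeling (Fan n)
large-fan-no-labeling 1 (s≤s ())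
large-fan-no-labeling (suc (suc p)) 8≤n (φ , E) = 5≰4 (≤-trans 5≤ψ₀ ψ₀≤4)
  where
  open CanonicalFanLabeling using (centre-label≤4)
  n = suc (suc p)
  ψ₀≤4 : suc n ∸ φ zero ≤ 4
  ψ₀≤4 = centre-label≤4 (complement E)
  5≤ψ₀ : 5 ≤ suc n ∸ φ zero
  5≤ψ₀ = ≤-trans (∸-monoˡ-≤ 4 (s≤s 8≤n)) (∸-monoʳ-≤ (suc n) (centre-label≤4 E))
  5≰4 : ¬ (5 ≤ 4)
  5≰4 (s≤s (s≤s (s≤s (s≤s ()))))

theorem3 : (n : ℕ) → 2 ≤ n → ((¬ HasCanonicalESDLabeling (Fan n)) ⇔ (8 ≤ n))
theorem3 n 2≤n = mk⇔
  (λ no-labeling → ≮⇒≥ (λ n<8 → no-labeling (small-fan-labeling n 2≤n n<8)))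
  (large-fan-no-labeling n)
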